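{- Let $G$ be the complete $k$-partite graph $K_{n_1,n_2,\dots,n_k}$ with each $n_i\geq 1$. Then $\eta(G)$ equals $k$ plus the maximum size of a matching in the complete $k$-partite graph $G'=K_{n_1-1,n_2-1,\dots,n_k-1}$ (where parts of size $0$ are allowed).
   Context: All graphs are finite, simple and undirected. A graph $H$ is a minor of $G$ if $H$ can be obtained from a subgraph of $G$ by contracting edges. The Hadwiger number $\eta(G)$ is the maximum $t$ such that the complete graph $K_t$ is a minor of $G$. A matching is a set of pairwise disjoint edges. -}

module Defs where

open import Data.Nat using (ℕ; _≤_; _∸_)
open import Data.Fin using (Fin)
open import Data.Bool using (Bool; true; false)
open import Data.Product using (Σ; ∃; ∃-syntax; _×_; _,_; proj₁; proj₂)
open import Data.Empty using (⊥)
open import Relation.Nullary using (¬_)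
open import Relation.Binary.PropositionalEquality using (_≡_; _≢_)

record Graph : Set₁ where
  field
    V      : Set
    Adj    : V → V → Set
    sym    : ∀ {u v} → Adj u v → Adj v u
    irrefl : ∀ {v} → ¬ Adj v v
open Graph public

data PathIn (G : Graph) (S : V G → Set) : V G → V G → Set where
  here : ∀ {x} → S x → PathIn G S x x
  step : ∀ {x y z} → S x → Adj G x y → PathIn G S y z → PathIn G S x z

ConnectedIn : (G : Graph) → (V G → Set) → Set
ConnectedIn G S = ∀ x y → S x → S y → PathIn G S x y

-- A minor model of H in G (branch sets): H is a minor of G iff H can be
-- obtained from a subgraph of G by contracting edges.
record MinorModel (H G : Graph) : Set₁ where
  field
    branch    : V H → V G → Set
    nonempty  : ∀ a → ∃[ v ] branch a v
    connected : ∀ a → ConnectedIn G (branch a)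
    disjoint  : ∀ {a b v} → a ≢ b → branch a v → branch b v → ⊥
    edges     : ∀ {a b} → Adj H a b →
                ∃[ u ] ∃[ v ] (branch a u × branch b v × Adj G u v)

_IsMinorOf_ : Graph → Graph → Set₁
H IsMinorOf G = MinorModel H G

K : ℕ → Graph
K t = record
  { V = Fin t
  ; Adj = λ i j → i ≢ j
  ; sym = λ ne eq → ne (Relation.Binary.PropositionalEquality.sym eq)
  ; irrefl = λ ne → ne Relation.Binary.PropositionalEquality.refl
  }

HadwigerNumber : Graph → ℕ → Set₁
HadwigerNumber G h = (K h IsMinorOf G) × (∀ t → K t IsMinorOf G → t ≤ h)

endpointOf : {V : Set} {m : ℕ} → (Fin m → V × V) → Fin m → Bool → V
endpointOf e i true  = proj₁ (e i)
endpointOf e i false = proj₂ (e i)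

-- A matching of size m: m edges whose 2m endpoints are pairwise distinct.
record Matching (G : Graph) (m : ℕ) : Set where
  field
    edge     : Fin m → V G × V G
    isEdge   : ∀ i → Adj G (proj₁ (edge i)) (proj₂ (edge i))
    disjoint : ∀ i j b c → endpointOf edge i b ≡ endpointOf edge j c →
               (i ≡ j × b ≡ c)

MatchingNumber : Graph → ℕ → Set
MatchingNumber G m = Matching G m × (∀ m' → Matching G m' → m' ≤ m)

CompleteMultipartite : (k : ℕ) → (Fin k → ℕ) → Graph
CompleteMultipartite k n = record
  { V = Σ (Fin k) (λ i → Fin (n i))
  ; Adj = λ x y → proj₁ x ≢ proj₁ y
  ; sym = λ ne eq → ne (Relation.Binary.PropositionalEquality.sym eq)
  ; irrefl = λ ne → ne Relation.Binary.PropositionalEquality.refl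
  }

{-# OPTIONS --safe #-}
module Submission where

-- Lower bound: choose one vertex in every part; a matching of G′ lives on the remaining vertices,
-- and the k chosen vertices together with the m matching edges are k + m connected, pairwise
-- adjacent branch sets (the ends of an edge lie in two different parts, so together they see every part).
-- Upper bound: take a K_(k+f) minor. Singleton branch sets are pairwise adjacent, hence lie in distinct
-- parts, so 2(k + f) ≤ |V| + k; no two branch sets lie inside the same part p, so k + f + n_p ≤ |V| + 1.
-- As |V′| = |V| − k, this says 2f ≤ |V′| and (n_p − 1) + f ≤ |V′|, which suffices for a matching of size
-- f in G′. Branch sets are arbitrary predicates, so each one is inspected only at its finitely many
-- contacts with the other branch sets; this makes the case distinctions decidable.

open import Defs hiding (sym)
open import Data.Nat using (ℕ; _+_; _∸_; _≤_)
open import Data.Fin using (Fin)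

import Data.Nat as ℕ
open import Data.Nat using (_<_; s≤s; z≤n)
open import Data.Nat.Properties hiding (_≟_)
open import Data.Nat.Tactic.RingSolver using (solve-∀)
open import Algebra.Properties.Monoid.Sum +-0-monoid using (sum)
import Data.Bool as Bool
open import Data.Bool using (Bool; true; false)
open import Data.Empty using (⊥-elim)
open import Data.Fin using (zero; suc; toℕ; fromℕ<; inject≤; splitAt; _↑ˡ_; _↑ʳ_; _≟_)
open import Data.Fin.Properties using (+↔⊎; any?; injective⇒≤; join-splitAt; splitAt-↑ˡ; splitAt-↑ʳ)
open import Data.Fin.Properties using (toℕ-↑ˡ; toℕ-↑ʳ; toℕ-fromℕ<; toℕ-inject≤; toℕ<n; toℕ-injective; inject≤-injective)
import Data.Product as Product
open import Data.Product using (∃; ∃-syntax; _×_; _,_; proj₁; proj₂)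
open import Data.Product.Properties using (≡-dec; ,-injectiveˡ)
open import Data.Product.Properties.WithK using (,-injectiveʳ)
open import Data.Sum using (_⊎_; inj₁; inj₂; [_,_])
open import Data.Sum.Function.Propositional using (_⊎-↔_)
open import Data.Sum.Properties using (inj₁-injective; inj₂-injective)
open import Data.Vec.Functional using (tail)
open import Function using (_∘_; id; _↔_; _↣_; mk↣; mk↔ₛ′; Injection; Injective)
open import Function.Construct.Composition using (_↣-∘_; _↔-∘_)
open import Function.Construct.Identity using (↔-id)
open import Function.Construct.Symmetry using (↔-sym)
open import Function.Properties.Inverse using (↔⇒↣)
open import Relation.Nullary using (¬_; Dec; yes; no; ¬?)
open import Relation.Nullary.Decidable using (map′; _⊎-dec_; decidable-stable)
open import Relation.Binary.PropositionalEquality using (_≡_; _≢_; refl; sym; trans; cong; cong₂; subst; subst₂)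
open import Relation.Binary.PropositionalEquality using (≢-sym; module ≡-Reasoning)

injection⇒≤ : ∀ {A B : Set} {a b} → A ↔ Fin a → B ↔ Fin b → A ↣ B → a ≤ b
injection⇒≤ A↔ B↔ f =
  injective⇒≤ (Injection.injective (↔⇒↣ B↔ ↣-∘ (f ↣-∘ ↔⇒↣ (↔-sym A↔))))

[,]-injective : ∀ {A B C : Set} {f : A → C} {g : B → C} →
                Injective _≡_ _≡_ f → Injective _≡_ _≡_ g → (∀ x y → f x ≢ g y) →
                Injective _≡_ _≡_ [ f , g ]
[,]-injective f-inj g-inj f≢g {inj₁ x} {inj₁ y} eq = cong inj₁ (f-inj eq)
[,]-injective f-inj g-inj f≢g {inj₁ x} {inj₂ y} eq = ⊥-elim (f≢g x y eq)
[,]-injective f-inj g-inj f≢g {inj₂ x} {inj₁ y} eq = ⊥-elim (f≢g y x (sym eq))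
[,]-injective f-inj g-inj f≢g {inj₂ x} {inj₂ y} eq = cong inj₂ (g-inj eq)

any×Bool? : ∀ {t} {P : Fin t × Bool → Set} → (∀ c → Dec (P c)) → Dec (∃ P)
any×Bool? P? =
  map′ (λ { (b , inj₁ p) → (b , true) , p ; (b , inj₂ p) → (b , false) , p })
       (λ { ((b , true) , p) → b , inj₁ p ; ((b , false) , p) → b , inj₂ p })
       (any? λ b → P? (b , true) ⊎-dec P? (b , false))

Vertex : ∀ {k} → (Fin k → ℕ) → Set
Vertex {k} n = V (CompleteMultipartite k n)

part : ∀ {k} {n : Fin k → ℕ} → Vertex n → Fin k
part = proj₁

_≟ᵥ_ : ∀ {k} {n : Fin k → ℕ} (u v : Vertex n) → Dec (u ≡ v)
_≟ᵥ_ = ≡-dec _≟_ _≟_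

index : ∀ {k} (n : Fin k → ℕ) → Vertex n → Fin (sum n)
index n (zero  , x) = x ↑ˡ sum (tail n)
index n (suc i , x) = n zero ↑ʳ index (tail n) (i , x)

vertexAt : ∀ {k} (n : Fin k → ℕ) → Fin (sum n) → Vertex n
vertexAt {ℕ.zero}  n ()
vertexAt {ℕ.suc k} n j = [ (zero ,_) , Product.map suc id ∘ vertexAt (tail n) ] (splitAt (n zero) j)

vertexAt-index : ∀ {k} (n : Fin k → ℕ) v → vertexAt n (index n v) ≡ v
vertexAt-index n (zero , x) rewrite splitAt-↑ˡ (n zero) x (sum (tail n)) = refl
vertexAt-index n (suc i , x)
  rewrite splitAt-↑ʳ (n zero) (sum (tail n)) (index (tail n) (i , x))
        | vertexAt-index (tail n) (i , x) = refl

index-vertexAt : ∀ {k} (n : Fin k → ℕ) j → index n (vertexAt n j) ≡ j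
index-vertexAt {ℕ.zero}  n ()
index-vertexAt {ℕ.suc k} n j with splitAt (n zero) j | join-splitAt (n zero) (sum (tail n)) j
... | inj₁ x  | refl = refl
... | inj₂ j′ | refl = cong (n zero ↑ʳ_) (index-vertexAt (tail n) j′)

vertices↔Fin : ∀ {k} (n : Fin k → ℕ) → Vertex n ↔ Fin (sum n)
vertices↔Fin n = mk↔ₛ′ (index n) (vertexAt n) (index-vertexAt n) (vertexAt-index n)

index-within-part : ∀ {k} (n : Fin k → ℕ) {u w : Vertex n} → part u ≡ part w →
                    toℕ (index n w) < toℕ (index n u) + n (part u)
index-within-part n {zero , x} {zero , y} refl = begin-strict
  toℕ (y ↑ˡ sum (tail n))                  ≡⟨ toℕ-↑ˡ y _ ⟩
  toℕ y                                    <⟨ toℕ<n y ⟩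
  n zero                                   ≤⟨ m≤n+m (n zero) _ ⟩
  toℕ (x ↑ˡ sum (tail n)) + n zero         ∎
  where open ≤-Reasoning
index-within-part n {suc i , x} {suc .i , y} refl = begin-strict
  toℕ (n zero ↑ʳ iy)              ≡⟨ toℕ-↑ʳ (n zero) iy ⟩
  n zero + toℕ iy                 <⟨ +-monoʳ-< (n zero) (index-within-part (tail n) refl) ⟩
  n zero + (toℕ ix + n (suc i))   ≡⟨ +-assoc (n zero) _ _ ⟨
  n zero + toℕ ix + n (suc i)     ≡⟨ cong (_+ n (suc i)) (toℕ-↑ʳ (n zero) ix) ⟨
  toℕ (n zero ↑ʳ ix) + n (suc i)  ∎
  where
  open ≤-Reasoning
  ix = index (tail n) (i , x)
  iy = index (tail n) (i , y)

vertex-injection⇒≤ : ∀ {k} (n : Fin k → ℕ) {a b d} →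
                     (Fin a ⊎ Fin b) ↣ (Vertex n ⊎ Fin d) → a + b ≤ sum n + d
vertex-injection⇒≤ n = injection⇒≤ (↔-sym +↔⊎) (↔-sym +↔⊎ ↔-∘ (vertices↔Fin n ⊎-↔ ↔-id _))

module _ {G : Graph} {m} (end : Fin m → Bool → V G) where

  endpointOf-pairs : ∀ i b → endpointOf (λ i → end i true , end i false) i b ≡ end i b
  endpointOf-pairs i true  = refl
  endpointOf-pairs i false = refl

  mkMatching : (∀ i → Adj G (end i true) (end i false)) →
               (∀ {i j b c} → end i b ≡ end j c → i ≡ j × b ≡ c) → Matching G m
  mkMatching adjacent apart = record
    { edge     = λ i → end i true , end i false
    ; isEdge   = adjacent
    ; disjoint = λ i j b c eq →
        apart (trans (sym (endpointOf-pairs i b)) (trans eq (endpointOf-pairs j c)))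
    }

mapMatching : ∀ {G H m} (φ : V G → V H) → Injective _≡_ _≡_ φ →
              (∀ {u v} → Adj G u v → Adj H (φ u) (φ v)) → Matching G m → Matching H m
mapMatching φ φ-injective φ-adj M =
  mkMatching (λ i b → φ (endpointOf edge i b)) (φ-adj ∘ isEdge)
             (λ eq → disjoint _ _ _ _ (φ-injective eq))
  where open Matching M

-- Vertex number e is paired with vertex number d + e; each part is an interval of at most d
-- consecutive numbers, so the two ends of a pair lie in different parts.
module ShiftedPairing {k} (n : Fin k → ℕ) {f d}
                      (d+f≡S : d + f ≡ sum n) (f≤d : f ≤ d) (n≤d : ∀ i → n i ≤ d) where

  offset : Bool → ℕ
  offset true  = 0
  offset false = d

  offset≤d : ∀ b → offset b ≤ d
  offset≤d true  = z≤n
  offset≤d false = ≤-refl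

  slot< : ∀ (e : Fin f) b → offset b + toℕ e < sum n
  slot< e b = begin-strict
    offset b + toℕ e  <⟨ +-monoʳ-< (offset b) (toℕ<n e) ⟩
    offset b + f      ≤⟨ +-monoˡ-≤ f (offset≤d b) ⟩
    d + f             ≡⟨ d+f≡S ⟩
    sum n             ∎
    where open ≤-Reasoning

  end : Fin f → Bool → Vertex n
  end e b = vertexAt n (fromℕ< (slot< e b))

  position-end : ∀ e b → toℕ (index n (end e b)) ≡ offset b + toℕ e
  position-end e b = trans (cong toℕ (index-vertexAt n _)) (toℕ-fromℕ< (slot< e b))

  offset-injective : ∀ {e e′} b c → offset b + toℕ e ≡ offset c + toℕ e′ → e ≡ e′ × b ≡ c
  offset-injective true  true  eq = toℕ-injective eq , refl
  offset-injective false false eq = toℕ-injective (+-cancelˡ-≡ d _ _ eq) , refl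
  offset-injective {e} true false eq =
    ⊥-elim (<⇒≱ (<-≤-trans (toℕ<n e) f≤d) (subst (d ≤_) (sym eq) (m≤m+n d _)))
  offset-injective {e′ = e′} false true eq =
    ⊥-elim (<⇒≱ (<-≤-trans (toℕ<n e′) f≤d) (subst (d ≤_) eq (m≤m+n d _)))

  end-injective : ∀ {e e′ b c} → end e b ≡ end e′ c → e ≡ e′ × b ≡ c
  end-injective {e} {e′} {b} {c} eq = offset-injective b c
    (trans (sym (position-end e b)) (trans (cong (toℕ ∘ index n) eq) (position-end e′ c)))

  ends-apart : ∀ e → part (end e true) ≢ part (end e false)
  ends-apart e same = <⇒≱ (+-cancelˡ-< (toℕ e) d _ shifted) (n≤d p)
    where
    open ≤-Reasoning
    p = part (end e true)
    shifted : toℕ e + d < toℕ e + n p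
    shifted = begin-strict
      toℕ e + d                         ≡⟨ +-comm (toℕ e) d ⟩
      d + toℕ e                         ≡⟨ position-end e false ⟨
      toℕ (index n (end e false))       <⟨ index-within-part n same ⟩
      toℕ (index n (end e true)) + n p  ≡⟨ cong (_+ n p) (position-end e true) ⟩
      toℕ e + n p                       ∎

  matching : Matching (CompleteMultipartite k n) f
  matching = mkMatching end ends-apart end-injective

completeMultipartite-matching : ∀ {k} (n : Fin k → ℕ) f →
                                f + f ≤ sum n → (∀ i → n i + f ≤ sum n) →
                                Matching (CompleteMultipartite k n) f
completeMultipartite-matching n f f+f≤S n+f≤S =
  ShiftedPairing.matching n (m∸n+n≡m (≤-trans (m≤n+m f f) f+f≤S)) (m+n≤o⇒m≤o∸n f f+f≤S)
                          (λ i → m+n≤o⇒m≤o∸n (n i) (n+f≤S i))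

transversal-clique-minor : ∀ {k} {n : Fin k → ℕ} {m} (top : ∀ i → Fin (n i)) →
                           (M : Matching (CompleteMultipartite k n) m) →
                           (∀ e b i → endpointOf (Matching.edge M) e b ≢ (i , top i)) →
                           K (k + m) IsMinorOf CompleteMultipartite k n
transversal-clique-minor {k} {n} {m} top M avoids = record
  { branch    = Branch ∘ splitAt k
  ; nonempty  = branch-nonempty ∘ splitAt k
  ; connected = branch-connected ∘ splitAt k
  ; disjoint  = λ a≢b u∈a u∈b → a≢b (splitAt-injective (branch-unique u∈a u∈b))
  ; edges     = λ a≢b → branch-adjacent (a≢b ∘ splitAt-injective)
  }
  where
  open Matching M
  G = CompleteMultipartite k n
  end = endpointOf edge

  splitAt-injective : Injective _≡_ _≡_ (splitAt k {m})
  splitAt-injective = Injection.injective (↔⇒↣ +↔⊎)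

  Branch : Fin k ⊎ Fin m → Vertex n → Set
  Branch (inj₁ i) v = v ≡ (i , top i)
  Branch (inj₂ e) v = ∃[ b ] v ≡ end e b

  branch-nonempty : ∀ s → ∃ (Branch s)
  branch-nonempty (inj₁ i) = _ , refl
  branch-nonempty (inj₂ e) = _ , true , refl

  ends-adjacent : ∀ e {b c} → b ≢ c → Adj G (end e b) (end e c)
  ends-adjacent e {true}  {true}  b≢c = ⊥-elim (b≢c refl)
  ends-adjacent e {true}  {false} _   = isEdge e
  ends-adjacent e {false} {true}  _   = ≢-sym (isEdge e)
  ends-adjacent e {false} {false} b≢c = ⊥-elim (b≢c refl)

  branch-connected : ∀ s → ConnectedIn G (Branch s)
  branch-connected (inj₁ i) _ _ refl refl = here refl
  branch-connected (inj₂ e) _ _ (b , refl) (c , refl) with b Bool.≟ c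
  ... | yes refl = here (b , refl)
  ... | no b≢c   = step (b , refl) (ends-adjacent e b≢c) (here (c , refl))

  branch-unique : ∀ {s s′ v} → Branch s v → Branch s′ v → s ≡ s′
  branch-unique {inj₁ i} {inj₁ j} p q       = cong (inj₁ ∘ part) (trans (sym p) q)
  branch-unique {inj₁ i} {inj₂ e} p (b , q) = ⊥-elim (avoids e b i (trans (sym q) p))
  branch-unique {inj₂ e} {inj₁ i} (b , p) q = ⊥-elim (avoids e b i (trans (sym p) q))
  branch-unique {inj₂ e} {inj₂ e′} (b , p) (c , q) =
    cong inj₂ (proj₁ (disjoint e e′ b c (trans (sym p) q)))

  end-outside : ∀ e i → ∃[ b ] part (end e b) ≢ i
  end-outside e i with part (end e true) ≟ i
  ... | yes refl = false , ≢-sym (isEdge e)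
  ... | no ≢i    = true , ≢i

  branch-adjacent : ∀ {s s′} → s ≢ s′ → ∃[ u ] ∃[ v ] (Branch s u × Branch s′ v × Adj G u v)
  branch-adjacent {inj₁ i} {inj₁ j} s≢s′ = _ , _ , refl , refl , s≢s′ ∘ cong inj₁
  branch-adjacent {inj₁ i} {inj₂ e} _ =
    let b , outside = end-outside e i in _ , _ , refl , (b , refl) , ≢-sym outside
  branch-adjacent {inj₂ e} {inj₁ i} _ =
    let b , outside = end-outside e i in _ , _ , (b , refl) , refl , outside
  branch-adjacent {inj₂ e} {inj₂ e′} _ =
    let b , outside = end-outside e (part (end e′ true))
    in _ , _ , (b , refl) , (true , refl) , outside

matching⇒clique-minor : ∀ {k} (n : Fin k → ℕ) → (∀ i → 1 ≤ n i) → ∀ {m} →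
                        Matching (CompleteMultipartite k (λ i → n i ∸ 1)) m →
                        K (k + m) IsMinorOf CompleteMultipartite k n
matching⇒clique-minor n n≥1 M =
  transversal-clique-minor top lifted lifted-avoids-top
  where
  top : ∀ i → Fin (n i)
  top i = fromℕ< (∸-monoʳ-< (s≤s z≤n) (n≥1 i))

  lift : Vertex (λ i → n i ∸ 1) → Vertex n
  lift (i , x) = i , inject≤ x (m∸n≤m (n i) 1)

  lift-injective : Injective _≡_ _≡_ lift
  lift-injective {i , x} {j , y} eq with ,-injectiveˡ eq
  ... | refl = cong (i ,_) (inject≤-injective _ _ x y (,-injectiveʳ eq))

  lift≢top : ∀ v i → lift v ≢ (i , top i)
  lift≢top (i , x) j eq with ,-injectiveˡ eq
  ... | refl = <-irrefl (cong toℕ (,-injectiveʳ eq)) (begin-strict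
    toℕ (inject≤ x (m∸n≤m (n i) 1))  ≡⟨ toℕ-inject≤ x _ ⟩
    toℕ x                             <⟨ toℕ<n x ⟩
    n i ∸ 1                           ≡⟨ toℕ-fromℕ< _ ⟨
    toℕ (top i)                       ∎)
    where open ≤-Reasoning

  lifted : Matching (CompleteMultipartite _ n) _
  lifted = mapMatching lift lift-injective id M

  lifted-avoids-top : ∀ e b i → endpointOf (Matching.edge lifted) e b ≢ (i , top i)
  lifted-avoids-top e true  i = lift≢top _ i
  lifted-avoids-top e false i = lift≢top _ i

module Contacts {G : Graph} {t} (model : K t IsMinorOf G) where
  open MinorModel model

  root : Fin t → V G
  root a = proj₁ (nonempty a)

  root-∈ : ∀ a → branch a (root a)
  root-∈ a = proj₂ (nonempty a)

  branch-unique : ∀ {a b v} → branch a v → branch b v → a ≡ b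
  branch-unique {a} {b} v∈a v∈b with a ≟ b
  ... | yes a≡b = a≡b
  ... | no a≢b  = ⊥-elim (disjoint a≢b v∈a v∈b)

  root-injective : Injective _≡_ _≡_ root
  root-injective {a} {b} eq = branch-unique (root-∈ a) (subst (branch b) (sym eq) (root-∈ b))

  -- For a ≢ b, contact a (b , true) and contact b (a , false) are the ends of the chosen edge between them.
  contact : Fin t → Fin t × Bool → V G
  contact a (b , true) with a ≟ b
  ... | yes _   = root a
  ... | no a≢b  = proj₁ (edges a≢b)
  contact a (b , false) with b ≟ a
  ... | yes _   = root a
  ... | no b≢a  = proj₁ (proj₂ (edges b≢a))

  contact-∈ : ∀ a c → branch a (contact a c)
  contact-∈ a (b , true) with a ≟ b
  ... | yes _   = root-∈ a
  ... | no a≢b  = proj₁ (proj₂ (proj₂ (edges a≢b)))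
  contact-∈ a (b , false) with b ≟ a
  ... | yes _   = root-∈ a
  ... | no b≢a  = proj₁ (proj₂ (proj₂ (proj₂ (edges b≢a))))

  contact-adjacent : ∀ {a b} → a ≢ b → Adj G (contact a (b , true)) (contact b (a , false))
  contact-adjacent {a} {b} a≢b with a ≟ b
  ... | yes a≡b  = ⊥-elim (a≢b a≡b)
  ... | no a≢b′  = proj₂ (proj₂ (proj₂ (proj₂ (edges a≢b′))))

  module Pick {L : Set} (P : Fin t → V G → Set) (P? : ∀ a v → Dec (P a v)) (label : Fin t → L) where

    Confined : Fin t → Set
    Confined a = ∀ c → P a (contact a c)

    Escapes : Fin t → Set
    Escapes a = ∃ λ c → ¬ P a (contact a c)

    escapes-or-confined : ∀ a → Escapes a ⊎ Confined a
    escapes-or-confined a with any×Bool? (λ c → ¬? (P? a (contact a c)))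
    ... | yes escapes  = inj₁ escapes
    ... | no ¬escapes  = inj₂ λ c →
      decidable-stable (P? a (contact a c)) (λ ¬p → ¬escapes (c , ¬p))

    pickFrom : ∀ a → Escapes a ⊎ Confined a → V G ⊎ L
    pickFrom a (inj₁ (c , _)) = inj₁ (contact a c)
    pickFrom a (inj₂ _)       = inj₂ (label a)

    pick : Fin t → V G ⊎ L
    pick a = pickFrom a (escapes-or-confined a)

    pickFrom-escapes : ∀ a e {v} → pickFrom a e ≡ inj₁ v → branch a v × ¬ P a v
    pickFrom-escapes a (inj₁ (c , ¬p)) refl = contact-∈ a c , ¬p

    pick-escapes : ∀ a {v} → pick a ≡ inj₁ v → branch a v × ¬ P a v
    pick-escapes a = pickFrom-escapes a (escapes-or-confined a)

    module _ (confined-apart : ∀ {a b} → a ≢ b → Confined a → Confined b → label a ≢ label b) where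

      pickFrom-injective : ∀ {a b} ea eb → pickFrom a ea ≡ pickFrom b eb → a ≡ b
      pickFrom-injective {a} {b} (inj₁ (c , _)) (inj₁ (c′ , _)) eq =
        branch-unique (contact-∈ a c) (subst (branch b) (sym (inj₁-injective eq)) (contact-∈ b c′))
      pickFrom-injective (inj₁ _) (inj₂ _) ()
      pickFrom-injective (inj₂ _) (inj₁ _) ()
      pickFrom-injective {a} {b} (inj₂ ca) (inj₂ cb) eq with a ≟ b
      ... | yes a≡b = a≡b
      ... | no a≢b  = ⊥-elim (confined-apart a≢b ca cb (inj₂-injective eq))

      pick-injective : Injective _≡_ _≡_ pick
      pick-injective {a} {b} = pickFrom-injective (escapes-or-confined a) (escapes-or-confined b)

module _ {k} {n : Fin k → ℕ} {t} (model : K t IsMinorOf CompleteMultipartite k n) where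
  open Contacts model

  clique-minor-size-bound : t + t ≤ sum n + k
  clique-minor-size-bound =
    vertex-injection⇒≤ n (mk↣ ([,]-injective (root-injective ∘ inj₁-injective)
                                             (pick-injective confined-apart) root≢pick))
    where
    open Pick (λ a v → v ≡ root a) (λ a v → v ≟ᵥ root a) (part ∘ root)

    confined-apart : ∀ {a b} → a ≢ b → Confined a → Confined b → part (root a) ≢ part (root b)
    confined-apart {a} {b} a≢b a-confined b-confined =
      subst₂ (λ u v → part u ≢ part v) (a-confined (b , true)) (b-confined (a , false))
             (contact-adjacent a≢b)

    root≢pick : ∀ a b → inj₁ (root a) ≢ pick b
    root≢pick a b eq =
      let root-a∈b , root-a≢root-b = pick-escapes b (sym eq)
      in root-a≢root-b (cong root (branch-unique (root-∈ a) root-a∈b))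

  clique-minor-part-bound : ∀ i → t + n i ≤ sum n + 1
  clique-minor-part-bound i =
    vertex-injection⇒≤ n (mk↣ ([,]-injective (pick-injective confined-apart)
                                             in-part-injective pick≢in-part))
    where
    open Pick (λ _ v → part v ≡ i) (λ _ v → part v ≟ i) (λ _ → zero)

    confined-apart : ∀ {a b} → a ≢ b → Confined a → Confined b → zero ≢ zero
    confined-apart {a} {b} a≢b a-confined b-confined _ =
      contact-adjacent a≢b (trans (a-confined (b , true)) (sym (b-confined (a , false))))

    in-part-injective : Injective _≡_ _≡_ (λ x → inj₁ (i , x))
    in-part-injective = ,-injectiveʳ ∘ inj₁-injective

    pick≢in-part : ∀ a x → pick a ≢ inj₁ (i , x)
    pick≢in-part a x eq = proj₂ (pick-escapes a eq) refl

sum-pred : ∀ {k} (n : Fin k → ℕ) → (∀ i → 1 ≤ n i) → sum (λ i → n i ∸ 1) + k ≡ sum n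
sum-pred {ℕ.zero}  n n≥1 = refl
sum-pred {ℕ.suc k} n n≥1 = begin
  (n zero ∸ 1 + sum (λ i → tail n i ∸ 1)) + ℕ.suc k  ≡⟨ regroup (n zero ∸ 1) _ k ⟩
  (n zero ∸ 1 + 1) + (sum (λ i → tail n i ∸ 1) + k)  ≡⟨ cong₂ _+_ (m∸n+n≡m (n≥1 zero))
                                                                (sum-pred (tail n) (n≥1 ∘ suc)) ⟩
  n zero + sum (tail n)                              ∎
  where
  open ≡-Reasoning
  regroup : ∀ a s k → (a + s) + ℕ.suc k ≡ (a + 1) + (s + k)
  regroup = solve-∀

cancel-excess : ∀ k f j x s → (k + f) + (j + x) ≤ (s + k) + j → x + f ≤ s
cancel-excess k f j x s le =
  +-cancelˡ-≤ (k + j) _ _ (subst₂ _≤_ (regroupˡ k f j x) (regroupʳ k j s) le)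
  where
  regroupˡ : ∀ k f j x → (k + f) + (j + x) ≡ (k + j) + (x + f)
  regroupˡ = solve-∀
  regroupʳ : ∀ k j s → (s + k) + j ≡ (k + j) + s
  regroupʳ = solve-∀

clique-minor⇒matching : ∀ {k} (n : Fin k → ℕ) → (∀ i → 1 ≤ n i) → ∀ {f} →
                        K (k + f) IsMinorOf CompleteMultipartite k n →
                        Matching (CompleteMultipartite k (λ i → n i ∸ 1)) f
clique-minor⇒matching {k} n n≥1 {f} model =
  completeMultipartite-matching (λ i → n i ∸ 1) f
    (cancel-excess k f k f S′
      (subst (λ s → (k + f) + (k + f) ≤ s + k) sum≡ (clique-minor-size-bound model)))
    (λ i → cancel-excess k f 1 (n i ∸ 1) S′
      (subst₂ (λ x s → (k + f) + x ≤ s + 1) (sym (m+[n∸m]≡n (n≥1 i))) sum≡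
              (clique-minor-part-bound model i)))
  where
  S′ : ℕ
  S′ = sum (λ i → n i ∸ 1)

  sum≡ : sum n ≡ S′ + k
  sum≡ = sym (sum-pred n n≥1)

lemma4 : (k : ℕ) (n : Fin k → ℕ) → (∀ i → 1 ≤ n i) →
         ∀ m → MatchingNumber (CompleteMultipartite k (λ i → n i ∸ 1)) m →
         HadwigerNumber (CompleteMultipartite k n) (k + m)
lemma4 k n n≥1 m (M , maximum) = matching⇒clique-minor n n≥1 M , bounded
  where
  bounded : ∀ t → K t IsMinorOf CompleteMultipartite k n → t ≤ k + m
  bounded t model with ≤-total t k
  ... | inj₁ t≤k = ≤-trans t≤k (m≤m+n k m)
  ... | inj₂ k≤t with m≤n⇒∃[o]m+o≡n k≤t
  ...   | f , refl = +-monoʳ-≤ k (maximum f (clique-minor⇒matching n n≥1 model))
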